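{- Let $G$ be a bipartite graph, let $S$ be a strong clique of $G$, and let $H$ be the subgraph of $G$ induced by the edge set $S$. If $H$ has a matching $M$ of size $m$, then $G[V(M)]$ contains a path $P_{2m}$ containing all edges of $M$. Moreover, if $m\ge 4$, then $G[V(M)]$ contains a cycle $C_{2m-2}$ using at least $m-2$ edges of $M$.
   Context: All graphs are finite and simple. $P_n$ and $C_n$ denote the path and the cycle on $n$ vertices. The distance between two edges of $G$ is the distance between the corresponding vertices in the line graph of $G$. A strong clique of $G$ is a set $S$ of edges such that every pair of edges in $S$ has distance at most $2$. For an edge set $S$, $G[S]$ (the subgraph induced by $S$) is the graph consisting of the edges of $S$ and their endpoints. For a set of edges $M$, $V(M)$ is the set of all endpoints of edges of $M$, and $G[V(M)]$ is the subgraph of $G$ induced by this vertex set. -}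

module Defs where

open import Data.Nat using (ℕ; suc; _∸_; _*_; _≤_)
open import Data.Fin using (Fin; toℕ)
open import Data.Bool using (Bool)
open import Data.Product using (Σ; ∃; _×_; _,_; proj₁; proj₂)
open import Data.Sum using (_⊎_)
open import Relation.Binary.PropositionalEquality using (_≡_; _≢_)
open import Relation.Nullary using (¬_)
open import Function.Definitions using (Injective)

record Graph (n : ℕ) : Set₁ where
  field
    Adj     : Fin n → Fin n → Set
    sym     : ∀ {u v} → Adj u v → Adj v u
    irrefl  : ∀ {u} → ¬ Adj u u
open Graph public

module _ {n : ℕ} (G : Graph n) where

  Bipartite : Set
  Bipartite = Σ (Fin n → Bool) λ col → ∀ u v → Adj G u v → col u ≢ col v

  -- an edge is written as a pair of endpoints (unordered in all notions below)
  Edge : Set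
  Edge = Fin n × Fin n

  IsEdge : Edge → Set
  IsEdge (u , v) = Adj G u v

  SameEdge : Edge → Edge → Set
  SameEdge (u , v) (x , y) = (u ≡ x × v ≡ y) ⊎ (u ≡ y × v ≡ x)

  Ends : Fin n → Edge → Set
  Ends w (u , v) = w ≡ u ⊎ w ≡ v

  ShareEnd : Edge → Edge → Set
  ShareEnd e f = ∃ λ w → Ends w e × Ends w f

  LineAdj : Edge → Edge → Set
  LineAdj e f = ¬ SameEdge e f × ShareEnd e f

  Dist≤2 : Edge → Edge → Set
  Dist≤2 e f = SameEdge e f ⊎ LineAdj e f
             ⊎ (∃ λ g → IsEdge g × LineAdj e g × LineAdj g f)

  StrongClique : (Edge → Set) → Set
  StrongClique S = (∀ e → S e → IsEdge e)
                 × (∀ e f → S e → S f → Dist≤2 e f)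

  IsMatchingIn : (Edge → Set) → (m : ℕ) → (Fin m → Edge) → Set
  IsMatchingIn S m M = (∀ i → S (M i))
                     × (∀ i j → i ≢ j → ¬ ShareEnd (M i) (M j))

  InV : {m : ℕ} → (Fin m → Edge) → Fin n → Set
  InV M v = ∃ λ i → Ends v (M i)

  IsPathIn : (Fin n → Set) → (k : ℕ) → (Fin k → Fin n) → Set
  IsPathIn W k p = Injective _≡_ _≡_ p
                 × (∀ i → W (p i))
                 × (∀ (i j : Fin k) → toℕ j ≡ suc (toℕ i) → Adj G (p i) (p j))

  PathEdge : (k : ℕ) → (Fin k → Fin n) → Edge → Set
  PathEdge k p e = ∃ λ (i : Fin k) → ∃ λ (j : Fin k) →
                   toℕ j ≡ suc (toℕ i) × SameEdge e (p i , p j)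

  IsCycleIn : (Fin n → Set) → (k : ℕ) → (Fin k → Fin n) → Set
  IsCycleIn W k c = (3 ≤ k) × IsPathIn W k c
                  × (∀ (i j : Fin k) → suc (toℕ i) ≡ k → toℕ j ≡ 0 → Adj G (c i) (c j))

  CycleEdge : (k : ℕ) → (Fin k → Fin n) → Edge → Set
  CycleEdge k c e = PathEdge k c e
                  ⊎ (∃ λ (i : Fin k) → ∃ λ (j : Fin k) →
                      suc (toℕ i) ≡ k × toℕ j ≡ 0 × SameEdge e (c i , c j))

-- Write M i = bᵢ aᵢ with bᵢ coloured false and aᵢ coloured true, and let i ⟶ j when aᵢ is
-- adjacent to b_j. For i ≠ j the edges M i and M j are disjoint, so the strong clique provides an
-- edge joining an end of M i to an end of M j; by bipartiteness it joins ends of opposite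
-- colours, hence i ⟶ j or j ⟶ i. A Hamiltonian path i₁ ⟶ ⋯ ⟶ iₘ of this semicomplete digraph
-- (Rédei) expands to the path b_{i₁} a_{i₁} ⋯ b_{iₘ} a_{iₘ} of G.
-- Inserting one vertex at a time (starting from four vertices) shows that a semicomplete digraph
-- on at least four vertices has either a Hamiltonian path x ⟶ x₂ ⟶ ⋯ ⟶ y′ ⟶ y with x ⟶ y, or
-- a cycle through all vertices but one. The first expands to the cycle
-- b_y a_x b_{x₂} a_{x₂} ⋯ b_{y′} a_{y′}, the second to the cycle through both ends of its m − 1
-- matching edges; both have 2m − 2 vertices and contain at least m − 2 edges of M.

module Submission where

open import Defs hiding (sym)
open import Data.Bool using (Bool; true; false; if_then_else_)
open import Data.Bool.Properties using (¬-not)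
open import Data.Empty using (⊥-elim)
open import Data.Fin using (Fin; toℕ; zero; suc)
open import Data.Fin.Properties using (_≟_)
open import Data.List using (List; []; _∷_; _∷ʳ_; length; lookup; allFin)
open import Data.List.Properties using (length-tabulate)
open import Data.List.Membership.Propositional using (_∈_)
open import Data.List.Membership.Propositional.Properties using (∈-lookup; ∈-allFin)
open import Data.List.Relation.Unary.All as All using (All; []; _∷_)
open import Data.List.Relation.Unary.AllPairs using ([]; _∷_)
open import Data.List.Relation.Unary.Any using (here; there)
open import Data.List.Relation.Unary.Unique.Propositional using (Unique)
open import Data.List.Relation.Unary.Unique.Propositional.Properties using (allFin⁺)
open import Data.List.Relation.Binary.Permutation.Propositional
  using (_↭_; ↭-refl; ↭-prep; ↭-swap; ↭-trans; ↭-sym; ↭⇒↭ₛ)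
open import Data.List.Relation.Binary.Permutation.Propositional.Properties
  using (All-resp-↭; ∈-resp-↭; ↭-length; ∷↭∷ʳ; shift)
import Data.List.Relation.Binary.Permutation.Setoid.Properties as Permutationₛ
open import Data.Nat using (ℕ; zero; suc; _+_; _*_; _∸_; _≤_; z≤n; s≤s)
open import Data.Nat.Properties using (*-suc; suc-injective)
open import Data.Product using (Σ; Σ-syntax; ∃₂; _×_; _,_; proj₁)
open import Data.Sum using (_⊎_; inj₁; inj₂)
open import Function using (_∘_; id)
open import Function.Definitions using (Injective)
open import Relation.Nullary using (¬_; yes; no)
open import Relation.Binary.PropositionalEquality
  using (_≡_; _≢_; refl; sym; trans; cong; subst; subst₂; ≢-sym; setoid)

data Walk {A : Set} (R : A → A → Set) : A → A → List A → Set where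
  [-] : ∀ {x} → Walk R x x (x ∷ [])
  _∷_ : ∀ {x y z xs} → R x y → Walk R y z xs → Walk R x z (x ∷ xs)

data Consecutive {A : Set} (u v : A) : List A → Set where
  here  : ∀ {xs} → Consecutive u v (u ∷ v ∷ xs)
  there : ∀ {x xs} → Consecutive u v xs → Consecutive u v (x ∷ xs)

module _ {A : Set} {R : A → A → Set} where

  lookup-start : ∀ {x y xs} → Walk R x y xs → ∀ i → toℕ i ≡ 0 → lookup xs i ≡ x
  lookup-start [-]     zero _ = refl
  lookup-start (_ ∷ _) zero _ = refl

  lookup-end : ∀ {x y xs} → Walk R x y xs → ∀ i → suc (toℕ i) ≡ length xs → lookup xs i ≡ y
  lookup-end [-]           zero    _  = refl
  lookup-end (_ ∷ W)       (suc i) eq = lookup-end W i (suc-injective eq)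
  lookup-end (_ ∷ [-])     zero    ()
  lookup-end (_ ∷ (_ ∷ _)) zero    ()

  lookup-step : ∀ {x y xs} → Walk R x y xs → ∀ i j → toℕ j ≡ suc (toℕ i) →
                R (lookup xs i) (lookup xs j)
  lookup-step (r ∷ W) zero    (suc j) eq =
    subst (R _) (sym (lookup-start W j (suc-injective eq))) r
  lookup-step (_ ∷ W) (suc i) (suc j) eq = lookup-step W i j (suc-injective eq)
  lookup-step [-]     zero    zero    ()
  lookup-step (_ ∷ _) zero    zero    ()

  end∈ : ∀ {x y xs} → Walk R x y xs → y ∈ xs
  end∈ [-]     = here refl
  end∈ (_ ∷ W) = there (end∈ W)

  snoc : ∀ {x y z xs} → Walk R x y xs → R y z → Walk R x z (xs ∷ʳ z)
  snoc [-]     r = r ∷ [-]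
  snoc (s ∷ W) r = s ∷ snoc W r

  unsnoc : ∀ {x y z xs} → R x y → Walk R y z xs →
           Σ[ z′ ∈ A ] Σ[ ys ∈ List A ] Walk R x z′ ys × R z′ z × ys ∷ʳ z ≡ x ∷ xs
  unsnoc {x} r [-] = x , x ∷ [] , [-] , r , refl
  unsnoc {x} r (s ∷ W) with unsnoc s W
  ... | z′ , ys , W′ , t , eq = z′ , x ∷ ys , r ∷ W′ , t , cong (x ∷_) eq

module _ {A : Set} where

  consecutive-lookup : ∀ {u v : A} {xs} → Consecutive u v xs →
                       ∃₂ λ i j → toℕ j ≡ suc (toℕ i) × lookup xs i ≡ u × lookup xs j ≡ v
  consecutive-lookup here = zero , suc zero , refl , refl , refl
  consecutive-lookup (there c) with consecutive-lookup c
  ... | i , j , eq , refl , refl = suc i , suc j , cong suc eq , refl , refl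

  lookup-injective : ∀ {xs : List A} → Unique xs → Injective _≡_ _≡_ (lookup xs)
  lookup-injective (_ ∷ _)     {zero}  {zero}  _  = refl
  lookup-injective (x∉ ∷ _)    {zero}  {suc j} eq = ⊥-elim (All.lookup x∉ (∈-lookup j) eq)
  lookup-injective (x∉ ∷ _)    {suc i} {zero}  eq = ⊥-elim (All.lookup x∉ (∈-lookup i) (sym eq))
  lookup-injective (_ ∷ xs-u)  {suc i} {suc j} eq = cong suc (lookup-injective xs-u eq)

  Unique-resp-↭ : ∀ {xs ys : List A} → xs ↭ ys → Unique xs → Unique ys
  Unique-resp-↭ p = Permutationₛ.Unique-resp-↭ (setoid A) (↭⇒↭ₛ p)

  last-to-front : ∀ {y : A} xs {ys} → xs ∷ʳ y ≡ ys → y ∷ xs ↭ ys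
  last-to-front xs refl = ∷↭∷ʳ _ xs

module _ {A : Set} (_⟶_ : A → A → Set) where

  record SpanningPath (L : List A) : Set where
    constructor spanningPath
    field
      {start end} : A
      {vertices}  : List A
      walk        : Walk _⟶_ start end vertices
      spans       : vertices ↭ L

  data AlmostHamiltonian (L : List A) : Set where
    shortcut-path : ∀ {x y P} → Walk _⟶_ x y P → x ⟶ y → P ↭ L → AlmostHamiltonian L
    cycle-missing : ∀ {u c d C} → Walk _⟶_ c d C → d ⟶ c → u ∷ C ↭ L → AlmostHamiltonian L

  AlmostHamiltonian-resp-↭ : ∀ {L L′} → L ↭ L′ → AlmostHamiltonian L → AlmostHamiltonian L′
  AlmostHamiltonian-resp-↭ q (shortcut-path W x⟶y p) = shortcut-path W x⟶y (↭-trans p q)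
  AlmostHamiltonian-resp-↭ q (cycle-missing W d⟶c p) = cycle-missing W d⟶c (↭-trans p q)

module Semicomplete {A : Set} (_⟶_ : A → A → Set)
                    (compare : ∀ {x y} → x ≢ y → x ⟶ y ⊎ y ⟶ x) where

  private
    Path : A → A → List A → Set
    Path = Walk _⟶_

    AH : List A → Set
    AH = AlmostHamiltonian _⟶_

    ↭-long : ∀ {P L : List A} → P ↭ L → 4 ≤ length L → 4 ≤ length P
    ↭-long p = subst (4 ≤_) (sym (↭-length p))

  -- Knowing that the new path starts at w or at s is what lets s be put back in front.
  insert : ∀ {s t P w} → Path s t P → All (w ≢_) P →
           Σ[ Q ∈ SpanningPath _⟶_ (w ∷ P) ] (SpanningPath.start Q ≡ w ⊎ SpanningPath.start Q ≡ s)
  insert {s} [-] (w≢s ∷ []) with compare w≢s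
  ... | inj₁ w⟶s = spanningPath (w⟶s ∷ [-]) ↭-refl , inj₁ refl
  ... | inj₂ s⟶w = spanningPath (s⟶w ∷ [-]) (↭-swap s _ ↭-refl) , inj₂ refl
  insert {s} (s⟶s₂ ∷ W) (w≢s ∷ w∉P) with compare w≢s
  ... | inj₁ w⟶s = spanningPath (w⟶s ∷ s⟶s₂ ∷ W) ↭-refl , inj₁ refl
  ... | inj₂ s⟶w with insert W w∉P
  ...   | spanningPath W′ p , inj₁ refl =
          spanningPath (s⟶w ∷ W′) (↭-trans (↭-prep s p) (↭-swap s _ ↭-refl)) , inj₂ refl
  ...   | spanningPath W′ p , inj₂ refl =
          spanningPath (s⟶s₂ ∷ W′) (↭-trans (↭-prep s p) (↭-swap s _ ↭-refl)) , inj₂ refl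

  hamiltonianPath : ∀ {x L} → Unique (x ∷ L) → SpanningPath _⟶_ (x ∷ L)
  hamiltonianPath {L = []} _ = spanningPath [-] ↭-refl
  hamiltonianPath {x} {L = _ ∷ _} (x∉L ∷ L-unique) with hamiltonianPath L-unique
  ... | spanningPath W p with insert W (All-resp-↭ (↭-sym p) x∉L)
  ...   | spanningPath W′ p′ , _ = spanningPath W′ (↭-trans p′ (↭-prep x p))

  data Insertion (x y w : A) (P : List A) : Set where
    between        : ∀ {P′} → Path x y P′ → P′ ↭ w ∷ x ∷ P → Insertion x y w P
    after-last-two : ∀ {z Q} → y ⟶ w → Path x z Q → z ⟶ w → Q ∷ʳ y ≡ x ∷ P → Insertion x y w P

  insert-after-start : ∀ {x x₂ y P w} → x ⟶ x₂ → Path x₂ y P → x ⟶ w → All (w ≢_) P →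
                       Insertion x y w P
  insert-after-start {x} x⟶x₂ [-] x⟶w (w≢y ∷ []) with compare w≢y
  ... | inj₁ w⟶y = between (x⟶w ∷ w⟶y ∷ [-]) (↭-swap x _ ↭-refl)
  ... | inj₂ y⟶w = after-last-two y⟶w [-] x⟶w refl
  insert-after-start {x} x⟶x₂ (x₂⟶x₃ ∷ W) x⟶w (w≢x₂ ∷ w∉P) with compare w≢x₂
  ... | inj₁ w⟶x₂ = between (x⟶w ∷ w⟶x₂ ∷ x₂⟶x₃ ∷ W) (↭-swap x _ ↭-refl)
  ... | inj₂ x₂⟶w with insert-after-start x₂⟶x₃ W x₂⟶w w∉P
  ...   | between W′ p = between (x⟶x₂ ∷ W′) (↭-trans (↭-prep x p) (↭-swap x _ ↭-refl))
  ...   | after-last-two y⟶w W′ z⟶w eq = after-last-two y⟶w (x⟶x₂ ∷ W′) z⟶w (cong (x ∷_) eq)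

  extend-shortcut-path : ∀ {w x x₂ x₃ y P} → x ⟶ x₂ → x₂ ⟶ x₃ → Path x₃ y P → x ⟶ y →
                         All (w ≢_) (x ∷ x₂ ∷ P) → AH (w ∷ x ∷ x₂ ∷ P)
  extend-shortcut-path {w} {x} {x₂} {P = P} x⟶x₂ x₂⟶x₃ W x⟶y (w≢x ∷ w≢x₂ ∷ w∉P)
    with compare w≢x | compare (All.lookup w∉P (end∈ W))
  ... | inj₂ x⟶w | _ with insert-after-start x⟶x₂ (x₂⟶x₃ ∷ W) x⟶w (w≢x₂ ∷ w∉P)
  ...   | between W′ p = shortcut-path W′ x⟶y p
  ...   | after-last-two y⟶w _ _ _ =
          shortcut-path (snoc (x⟶x₂ ∷ x₂⟶x₃ ∷ W) y⟶w) x⟶w (↭-sym (∷↭∷ʳ w (x ∷ x₂ ∷ P)))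
  extend-shortcut-path x⟶x₂ x₂⟶x₃ W _ _ | inj₁ w⟶x | inj₁ w⟶y =
    shortcut-path (w⟶x ∷ x⟶x₂ ∷ x₂⟶x₃ ∷ W) w⟶y ↭-refl
  extend-shortcut-path {w} {x} x⟶x₂ x₂⟶x₃ W x⟶y (_ ∷ w≢x₂ ∷ w∉P) | inj₁ w⟶x | inj₂ y⟶w
    with compare w≢x₂
  ... | inj₁ w⟶x₂ = cycle-missing (w⟶x₂ ∷ x₂⟶x₃ ∷ W) y⟶w (↭-swap x w ↭-refl)
  ... | inj₂ x₂⟶w with insert-after-start x₂⟶x₃ W x₂⟶w w∉P
  ...   | between W′ p =
          shortcut-path (x⟶x₂ ∷ W′) x⟶y (↭-trans (↭-prep x p) (↭-swap x w ↭-refl))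
  ...   | after-last-two {Q = Q} _ W′ z⟶w eq =
          cycle-missing (w⟶x ∷ x⟶x₂ ∷ W′) z⟶w
            (last-to-front (w ∷ x ∷ Q) (cong (λ R → w ∷ x ∷ R) eq))

  data Outside (c d z : A) (C : List A) : Set where
    dominates : z ⟶ c → z ⟶ d → Outside c d z C
    dominated : ∀ {ζ Q} → c ⟶ z → d ⟶ z → Path c ζ Q → ζ ⟶ z → Q ∷ʳ d ≡ C → Outside c d z C

  data CyclePosition (c d z : A) (C : List A) : Set where
    inside  : ∀ {c′ d′ C′} → Path c′ d′ C′ → d′ ⟶ c′ → C′ ↭ z ∷ C → CyclePosition c d z C
    outside : Outside c d z C → CyclePosition c d z C

  locate : ∀ {c c₂ d C z} → c ⟶ c₂ → Path c₂ d C → d ⟶ c → All (z ≢_) (c ∷ C) →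
           CyclePosition c d z (c ∷ C)
  locate c⟶c₂ W d⟶c (z≢c ∷ z∉C) with compare z≢c
  ... | inj₂ c⟶z with insert-after-start c⟶c₂ W c⟶z z∉C
  ...   | between W′ p = inside W′ d⟶c p
  ...   | after-last-two d⟶z W′ ζ⟶z eq = outside (dominated c⟶z d⟶z W′ ζ⟶z eq)
  locate {c} {C = C} {z} c⟶c₂ W d⟶c (_ ∷ z∉C) | inj₁ z⟶c
    with compare (All.lookup z∉C (end∈ W))
  ... | inj₁ z⟶d = outside (dominates z⟶c z⟶d)
  ... | inj₂ d⟶z = inside (snoc (c⟶c₂ ∷ W) d⟶z) z⟶c (↭-sym (∷↭∷ʳ z (c ∷ C)))

  outside-pair : ∀ {a b c c₂ d C} → c ⟶ c₂ → Path c₂ d C → a ⟶ b →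
                 Outside c d a (c ∷ C) → Outside c d b (c ∷ C) → AH (a ∷ b ∷ c ∷ C)
  outside-pair c⟶c₂ W a⟶b (dominates _ a⟶d) (dominates b⟶c _) =
    shortcut-path (a⟶b ∷ b⟶c ∷ c⟶c₂ ∷ W) a⟶d ↭-refl
  outside-pair {a} {b} {c} {C = C} c⟶c₂ W a⟶b (dominated _ d⟶a _ _ _) (dominated c⟶b _ _ _ _) =
    shortcut-path (snoc (snoc (c⟶c₂ ∷ W) d⟶a) a⟶b) c⟶b
      (↭-trans (↭-sym (∷↭∷ʳ b ((c ∷ C) ∷ʳ a)))
        (↭-trans (↭-prep b (↭-sym (∷↭∷ʳ a (c ∷ C)))) (↭-swap b a ↭-refl)))
  outside-pair {a} {b} {c} {C = C} c⟶c₂ W a⟶b (dominates a⟶c _) (dominated _ d⟶b _ _ _) =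
    shortcut-path (snoc (a⟶c ∷ c⟶c₂ ∷ W) d⟶b) a⟶b
      (↭-trans (↭-sym (∷↭∷ʳ b (a ∷ c ∷ C))) (↭-swap b a ↭-refl))
  outside-pair {a} {b} c⟶c₂ W a⟶b (dominated {Q = Q} _ _ V ζ⟶a eq) (dominates b⟶c _) =
    cycle-missing (a⟶b ∷ b⟶c ∷ V) ζ⟶a
      (last-to-front (a ∷ b ∷ Q) (cong (λ R → a ∷ b ∷ R) eq))

  extend-cycle : ∀ {u w c c₂ d C} → c ⟶ c₂ → Path c₂ d C → d ⟶ c → u ≢ w →
                 All (u ≢_) (c ∷ C) → All (w ≢_) (c ∷ C) → AH (w ∷ u ∷ c ∷ C)
  extend-cycle {u} {w} c⟶c₂ W d⟶c u≢w u∉C w∉C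
    with locate c⟶c₂ W d⟶c w∉C | locate c⟶c₂ W d⟶c u∉C
  ... | inside W′ d′⟶c′ p | _ =
        cycle-missing W′ d′⟶c′ (↭-trans (↭-prep u p) (↭-swap u w ↭-refl))
  ... | outside _ | inside W′ d′⟶c′ p = cycle-missing W′ d′⟶c′ (↭-prep w p)
  ... | outside ow | outside ou with compare u≢w
  ...   | inj₁ u⟶w =
          AlmostHamiltonian-resp-↭ _⟶_ (↭-swap u w ↭-refl) (outside-pair c⟶c₂ W u⟶w ou ow)
  ...   | inj₂ w⟶u = outside-pair c⟶c₂ W w⟶u ow ou

  four-vertices : ∀ {s t P} → Path s t P → length P ≡ 4 → Unique P → AH P
  four-vertices {P = v₁ ∷ v₂ ∷ v₃ ∷ v₄ ∷ []} (v₁⟶v₂ ∷ v₂⟶v₃ ∷ v₃⟶v₄ ∷ [-]) _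
                ((_ ∷ v₁≢v₃ ∷ v₁≢v₄ ∷ []) ∷ (_ ∷ v₂≢v₄ ∷ []) ∷ _) with compare v₁≢v₄
  ... | inj₁ v₁⟶v₄ = shortcut-path (v₁⟶v₂ ∷ v₂⟶v₃ ∷ v₃⟶v₄ ∷ [-]) v₁⟶v₄ ↭-refl
  ... | inj₂ v₄⟶v₁ with compare v₁≢v₃
  ...   | inj₁ v₁⟶v₃ = cycle-missing (v₁⟶v₃ ∷ v₃⟶v₄ ∷ [-]) v₄⟶v₁ (↭-swap v₂ v₁ ↭-refl)
  ...   | inj₂ v₃⟶v₁ with compare v₂≢v₄
  ...     | inj₁ v₂⟶v₄ = cycle-missing (v₁⟶v₂ ∷ v₂⟶v₄ ∷ [-]) v₄⟶v₁
                           (↭-trans (↭-swap v₃ v₁ ↭-refl) (↭-prep v₁ (↭-swap v₃ v₂ ↭-refl)))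
  ...     | inj₂ v₄⟶v₂ = shortcut-path (v₄⟶v₂ ∷ v₂⟶v₃ ∷ v₃⟶v₁ ∷ [-]) v₄⟶v₁
                           (↭-trans (∷↭∷ʳ v₄ (v₂ ∷ v₃ ∷ v₁ ∷ []))
                                    (shift v₁ (v₂ ∷ v₃ ∷ []) (v₄ ∷ [])))
  four-vertices [-]                   ()
  four-vertices (_ ∷ [-])             ()
  four-vertices (_ ∷ _ ∷ [-])         ()
  four-vertices (_ ∷ _ ∷ _ ∷ _ ∷ _ ∷ _) ()

  extend : ∀ {w L} → All (w ≢_) L → Unique L → 4 ≤ length L → AH L → AH (w ∷ L)
  extend w∉L _ _ (shortcut-path (x⟶x₂ ∷ x₂⟶x₃ ∷ W) x⟶y p) =
    AlmostHamiltonian-resp-↭ _⟶_ (↭-prep _ p)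
      (extend-shortcut-path x⟶x₂ x₂⟶x₃ W x⟶y (All-resp-↭ (↭-sym p) w∉L))
  extend w∉L L-unique _ (cycle-missing (c⟶c₂ ∷ W) d⟶c p)
    with All-resp-↭ (↭-sym p) w∉L | Unique-resp-↭ (↭-sym p) L-unique
  ... | w≢u ∷ w∉C | u∉C ∷ _ =
    AlmostHamiltonian-resp-↭ _⟶_ (↭-prep _ p) (extend-cycle c⟶c₂ W d⟶c (≢-sym w≢u) u∉C w∉C)
  extend _ _ 4≤L (shortcut-path [-] _ p) with ↭-long p 4≤L
  ... | s≤s ()
  extend _ _ 4≤L (shortcut-path (_ ∷ [-]) _ p) with ↭-long p 4≤L
  ... | s≤s (s≤s ())
  extend _ _ 4≤L (cycle-missing [-] _ p) with ↭-long p 4≤L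
  ... | s≤s (s≤s ())

  almostHamiltonian : ∀ {L} → Unique L → 4 ≤ length L → AH L
  almostHamiltonian {_ ∷ _ ∷ _ ∷ _ ∷ []} L-unique _ with hamiltonianPath L-unique
  ... | spanningPath W p =
    AlmostHamiltonian-resp-↭ _⟶_ p
      (four-vertices W (↭-length p) (Unique-resp-↭ (↭-sym p) L-unique))
  almostHamiltonian {_ ∷ L@(_ ∷ _ ∷ _ ∷ _ ∷ _)} (w∉L ∷ L-unique) _ =
    extend w∉L L-unique 4≤L (almostHamiltonian L-unique 4≤L)
    where
      4≤L : 4 ≤ length L
      4≤L = s≤s (s≤s (s≤s (s≤s z≤n)))
  almostHamiltonian {[]}             _ ()
  almostHamiltonian {_ ∷ []}         _ (s≤s ())
  almostHamiltonian {_ ∷ _ ∷ []}     _ (s≤s (s≤s ()))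
  almostHamiltonian {_ ∷ _ ∷ _ ∷ []} _ (s≤s (s≤s (s≤s ())))

module _ {n : ℕ} (G : Graph n) where

  SameEdge⇒ShareEnd : ∀ {e f} → SameEdge G e f → ShareEnd G e f
  SameEdge⇒ShareEnd {u , _} (inj₁ (u≡x , _)) = u , inj₁ refl , inj₁ u≡x
  SameEdge⇒ShareEnd {u , _} (inj₂ (u≡y , _)) = u , inj₁ refl , inj₂ u≡y

  SameEdge⇒Adj : ∀ {e x y} → SameEdge G e (x , y) → IsEdge G e → Adj G x y
  SameEdge⇒Adj (inj₁ (refl , refl)) uv = uv
  SameEdge⇒Adj (inj₂ (refl , refl)) uv = Graph.sym G uv

  Ends⇒Adj : ∀ {g w₁ w₂} → IsEdge G g → Ends G w₁ g → Ends G w₂ g → w₁ ≢ w₂ → Adj G w₁ w₂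
  Ends⇒Adj uv (inj₁ refl) (inj₁ refl) w₁≢w₂ = ⊥-elim (w₁≢w₂ refl)
  Ends⇒Adj uv (inj₁ refl) (inj₂ refl) _     = uv
  Ends⇒Adj uv (inj₂ refl) (inj₁ refl) _     = Graph.sym G uv
  Ends⇒Adj uv (inj₂ refl) (inj₂ refl) w₁≢w₂ = ⊥-elim (w₁≢w₂ refl)

  module FromWalks {B : Set} (f : B → Fin n) (f-injective : Injective _≡_ _≡_ f)
                   (W : Fin n → Set) (W-f : ∀ b → W (f b)) where

    private
      _~_ : B → B → Set
      a ~ b = Adj G (f a) (f b)

    walk⇒IsPathIn : ∀ {x y H} → Walk _~_ x y H → Unique H → IsPathIn G W (length H) (f ∘ lookup H)
    walk⇒IsPathIn {H = H} V H-unique =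
      lookup-injective H-unique ∘ f-injective , W-f ∘ lookup H , lookup-step V

    closedWalk⇒IsCycleIn : ∀ {x y H} → 3 ≤ length H → Walk _~_ x y H → y ~ x → Unique H →
                           IsCycleIn G W (length H) (f ∘ lookup H)
    closedWalk⇒IsCycleIn {H = H} 3≤H V y~x H-unique = 3≤H , walk⇒IsPathIn V H-unique , closing
      where
        closing : ∀ i j → suc (toℕ i) ≡ length H → toℕ j ≡ 0 → lookup H i ~ lookup H j
        closing i j i-last j-first rewrite lookup-end V i i-last | lookup-start V j j-first = y~x

  consecutive⇒PathEdge : ∀ {B : Set} (f : B → Fin n) {a b H e} → Consecutive a b H →
                         SameEdge G e (f a , f b) → PathEdge G (length H) (f ∘ lookup H) e
  consecutive⇒PathEdge f {e = e} ab∈H e≡ab with consecutive-lookup ab∈H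
  ... | i , j , j≡1+i , refl , refl = i , j , j≡1+i , e≡ab

module Bipartition {n : ℕ} (G : Graph n) (col : Fin n → Bool)
                   (proper : ∀ u v → Adj G u v → col u ≢ col v) where

  end : Bool → Edge G → Fin n
  end true  (u , v) = if col u then u else v
  end false (u , v) = if col u then v else u

  col-end : ∀ c {e} → IsEdge G e → col (end c e) ≡ c
  col-end true  {u , v} uv with col u in col-u | ¬-not (≢-sym (proper u v uv))
  ... | true  | _     = col-u
  ... | false | col-v = col-v
  col-end false {u , v} uv with col u in col-u | ¬-not (≢-sym (proper u v uv))
  ... | true  | col-v = col-v
  ... | false | _     = col-u

  end-Ends : ∀ c e → Ends G (end c e) e
  end-Ends true (u , v) with col u
  ... | true  = inj₁ refl
  ... | false = inj₂ refl
  end-Ends false (u , v) with col u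
  ... | true  = inj₂ refl
  ... | false = inj₁ refl

  Ends-end : ∀ {w} e → Ends G w e → w ≡ end true e ⊎ w ≡ end false e
  Ends-end (u , v) w∈e with col u
  Ends-end (u , v) (inj₁ w≡u) | true  = inj₁ w≡u
  Ends-end (u , v) (inj₂ w≡v) | true  = inj₂ w≡v
  Ends-end (u , v) (inj₁ w≡u) | false = inj₂ w≡u
  Ends-end (u , v) (inj₂ w≡v) | false = inj₁ w≡v

  end-SameEdge : ∀ e → SameEdge G e (end false e , end true e)
  end-SameEdge (u , v) with col u
  ... | true  = inj₂ (refl , refl)
  ... | false = inj₁ (refl , refl)

  module Matching {m : ℕ} (M : Fin m → Edge G) (M-edge : ∀ i → IsEdge G (M i))
                  (M-disjoint : ∀ i j → i ≢ j → ¬ ShareEnd G (M i) (M j)) where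

    vertex : Fin m × Bool → Fin n
    vertex (i , c) = end c (M i)

    vertex-injective : Injective _≡_ _≡_ vertex
    vertex-injective {i , c} {j , c′} eq with i ≟ j
    ... | yes refl =
          cong (i ,_) (trans (sym (col-end c (M-edge i)))
                             (trans (cong col eq) (col-end c′ (M-edge i))))
    ... | no i≢j = ⊥-elim (M-disjoint i j i≢j (vertex (i , c) , end-Ends c (M i) , ends-j))
      where
        ends-j : Ends G (vertex (i , c)) (M j)
        ends-j = subst (λ w → Ends G w (M j)) (sym eq) (end-Ends c′ (M j))

    vertex-InV : ∀ p → InV G M (vertex p)
    vertex-InV (i , c) = i , end-Ends c (M i)

    open FromWalks G vertex vertex-injective (InV G M) vertex-InV

    _~_ : Fin m × Bool → Fin m × Bool → Set
    p ~ q = Adj G (vertex p) (vertex q)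

    _⟶_ : Fin m → Fin m → Set
    i ⟶ j = (i , true) ~ (j , false)

    matched : ∀ i → (i , false) ~ (i , true)
    matched i = SameEdge⇒Adj G (end-SameEdge (M i)) (M-edge i)

    same-colour-nonadjacent : ∀ {i j} c → ¬ (i , c) ~ (j , c)
    same-colour-nonadjacent {i} {j} c adj =
      proper _ _ adj (trans (col-end c (M-edge i)) (sym (col-end c (M-edge j))))

    adjacent-ends : ∀ {i j} → i ≢ j → Dist≤2 G (M i) (M j) →
                    ∃₂ λ w₁ w₂ → Ends G w₁ (M i) × Ends G w₂ (M j) × Adj G w₁ w₂
    adjacent-ends i≢j (inj₁ same) = ⊥-elim (M-disjoint _ _ i≢j (SameEdge⇒ShareEnd G same))
    adjacent-ends i≢j (inj₂ (inj₁ (_ , shared))) = ⊥-elim (M-disjoint _ _ i≢j shared)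
    adjacent-ends i≢j (inj₂ (inj₂ (g , g-edge , (_ , w₁ , w₁∈i , w₁∈g) , (_ , w₂ , w₂∈g , w₂∈j)))) =
      w₁ , w₂ , w₁∈i , w₂∈j ,
      Ends⇒Adj G g-edge w₁∈g w₂∈g λ { refl → M-disjoint _ _ i≢j (w₁ , w₁∈i , w₂∈j) }

    orient : ∀ {i j w₁ w₂} → Ends G w₁ (M i) → Ends G w₂ (M j) → Adj G w₁ w₂ → i ⟶ j ⊎ j ⟶ i
    orient w₁∈i w₂∈j adj with Ends-end _ w₁∈i | Ends-end _ w₂∈j
    ... | inj₁ refl | inj₂ refl = inj₁ adj
    ... | inj₂ refl | inj₁ refl = inj₂ (Graph.sym G adj)
    ... | inj₁ refl | inj₁ refl = ⊥-elim (same-colour-nonadjacent true adj)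
    ... | inj₂ refl | inj₂ refl = ⊥-elim (same-colour-nonadjacent false adj)

    compare : ∀ {i j} → i ≢ j → Dist≤2 G (M i) (M j) → i ⟶ j ⊎ j ⟶ i
    compare i≢j close with adjacent-ends i≢j close
    ... | _ , _ , w₁∈i , w₂∈j , adj = orient w₁∈i w₂∈j adj

    expand : List (Fin m) → List (Fin m × Bool)
    expand []      = []
    expand (i ∷ P) = (i , false) ∷ (i , true) ∷ expand P

    expand-walk : ∀ {s t P} → Walk _⟶_ s t P → Walk _~_ (s , false) (t , true) (expand P)
    expand-walk {s} [-]         = matched s ∷ [-]
    expand-walk {s} (s⟶s₂ ∷ W) = matched s ∷ s⟶s₂ ∷ expand-walk W

    length-expand : ∀ P → length (expand P) ≡ 2 * length P
    length-expand []      = refl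
    length-expand (_ ∷ P) = trans (cong (2 +_) (length-expand P)) (sym (*-suc 2 (length P)))

    expand-∉ : ∀ {i c P} → All (i ≢_) P → All ((i , c) ≢_) (expand P)
    expand-∉ []          = []
    expand-∉ (i≢j ∷ i∉P) = (i≢j ∘ cong proj₁) ∷ (i≢j ∘ cong proj₁) ∷ expand-∉ i∉P

    expand-unique : ∀ {P} → Unique P → Unique (expand P)
    expand-unique []               = []
    expand-unique (i∉P ∷ P-unique) =
      ((λ ()) ∷ expand-∉ i∉P) ∷ expand-∉ i∉P ∷ expand-unique P-unique

    expand-consecutive : ∀ {i P} → i ∈ P → Consecutive (i , false) (i , true) (expand P)
    expand-consecutive (here refl) = here
    expand-consecutive (there i∈P) = there (there (expand-consecutive i∈P))

    PathThrough : ℕ → Set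
    PathThrough k =
      Σ (Fin k → Fin n) λ p → IsPathIn G (InV G M) k p × (∀ i → PathEdge G k p (M i))

    CycleThrough : ℕ → ℕ → Set
    CycleThrough k l =
      Σ (Fin k → Fin n) λ c → IsCycleIn G (InV G M) k c
        × Σ (Fin l → Fin m) λ f → Injective _≡_ _≡_ f × (∀ j → CycleEdge G k c (M (f j)))

    M-PathEdge : ∀ {i H} → Consecutive (i , false) (i , true) H →
                 PathEdge G (length H) (vertex ∘ lookup H) (M i)
    M-PathEdge {i} i∈H = consecutive⇒PathEdge G vertex i∈H (end-SameEdge (M i))

    length-spanning : ∀ {P} → P ↭ allFin m → length P ≡ m
    length-spanning p = trans (↭-length p) (length-tabulate id)

    unique-spanning : ∀ {P} → P ↭ allFin m → Unique P
    unique-spanning p = Unique-resp-↭ (↭-sym p) (allFin⁺ m)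

    long-spanning : ∀ {P} → P ↭ allFin m → 4 ≤ m → 4 ≤ length P
    long-spanning p = subst (4 ≤_) (sym (length-spanning p))

    SpanningPath⇒PathThrough : SpanningPath _⟶_ (allFin m) → PathThrough (2 * m)
    SpanningPath⇒PathThrough (spanningPath {vertices = P} W p) =
      subst PathThrough (trans (length-expand P) (cong (2 *_) (length-spanning p)))
        ( vertex ∘ lookup (expand P)
        , walk⇒IsPathIn (expand-walk W) (expand-unique (unique-spanning p))
        , λ i → M-PathEdge (expand-consecutive (∈-resp-↭ (↭-sym p) (∈-allFin i))) )

    3≤cycle-length : ∀ {a b} R → 2 + length R ≡ m → 4 ≤ m → 3 ≤ length (a ∷ b ∷ expand R)
    3≤cycle-length (_ ∷ _) _ _ = s≤s (s≤s (s≤s z≤n))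
    3≤cycle-length [] size 4≤m with subst (4 ≤_) (sym size) 4≤m
    ... | s≤s (s≤s ())

    2+2*k≡2*[2+k]∸2 : ∀ k → 2 + 2 * k ≡ 2 * (2 + k) ∸ 2
    2+2*k≡2*[2+k]∸2 k = trans (sym (*-suc 2 k)) (cong (_∸ 2) (sym (*-suc 2 (suc k))))

    closedWalk⇒CycleThrough : ∀ {a b z R} → Walk _~_ a z (a ∷ b ∷ expand R) → z ~ a →
                              Unique (a ∷ b ∷ expand R) → Unique R → 2 + length R ≡ m → 4 ≤ m →
                              CycleThrough (2 * m ∸ 2) (m ∸ 2)
    closedWalk⇒CycleThrough {a} {b} {R = R} V z~a H-unique R-unique size 4≤m =
      subst₂ CycleThrough length-H (cong (_∸ 2) size)
        ( vertex ∘ lookup H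
        , closedWalk⇒IsCycleIn (3≤cycle-length {a} {b} R size 4≤m) V z~a H-unique
        , lookup R , lookup-injective R-unique
        , λ j → inj₁ (M-PathEdge (there (there (expand-consecutive (∈-lookup j))))) )
      where
        H : List (Fin m × Bool)
        H = a ∷ b ∷ expand R
        length-H : length H ≡ 2 * m ∸ 2
        length-H = trans (cong (2 +_) (length-expand R))
                         (trans (2+2*k≡2*[2+k]∸2 (length R)) (cong (λ k → 2 * k ∸ 2) size))

    AlmostHamiltonian⇒CycleThrough : 4 ≤ m → AlmostHamiltonian _⟶_ (allFin m) →
                                     CycleThrough (2 * m ∸ 2) (m ∸ 2)
    AlmostHamiltonian⇒CycleThrough 4≤m (shortcut-path {x} {y} (x⟶x₂ ∷ x₂⟶x₃ ∷ W) x⟶y p)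
      with unsnoc x₂⟶x₃ W
    ... | _ , R , W′ , y′⟶y , R∷ʳy≡
      with spans ← ↭-trans (↭-swap y x ↭-refl) (↭-trans (↭-prep x (last-to-front R R∷ʳy≡)) p)
         | unique-spanning spans
    ... | (_ ∷ y∉R) ∷ x∉R ∷ R-unique =
      closedWalk⇒CycleThrough {a = y , false} {b = x , true}
        (Graph.sym G x⟶y ∷ x⟶x₂ ∷ expand-walk W′) y′⟶y
        (((λ ()) ∷ expand-∉ y∉R) ∷ expand-∉ x∉R ∷ expand-unique R-unique) R-unique
        (length-spanning spans) 4≤m
    AlmostHamiltonian⇒CycleThrough 4≤m (cycle-missing W@(_ ∷ _) d⟶c p) with unique-spanning p
    ... | _ ∷ C-unique@(_ ∷ R-unique) =
      closedWalk⇒CycleThrough (expand-walk W) d⟶c (expand-unique C-unique) R-unique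
        (length-spanning p) 4≤m
    AlmostHamiltonian⇒CycleThrough 4≤m (cycle-missing [-] _ p) with long-spanning p 4≤m
    ... | s≤s (s≤s ())
    AlmostHamiltonian⇒CycleThrough 4≤m (shortcut-path [-] _ p) with long-spanning p 4≤m
    ... | s≤s ()
    AlmostHamiltonian⇒CycleThrough 4≤m (shortcut-path (_ ∷ [-]) _ p) with long-spanning p 4≤m
    ... | s≤s (s≤s ())

lemma2p1 : {n : ℕ} (G : Graph n) → Bipartite G →
    (S : Edge G → Set) → StrongClique G S →
    (m : ℕ) (M : Fin m → Edge G) → IsMatchingIn G S m M →
    (Σ (Fin (2 * m) → Fin n) λ p →
        IsPathIn G (InV G M) (2 * m) p × (∀ i → PathEdge G (2 * m) p (M i)))
    × (4 ≤ m →
        Σ (Fin (2 * m ∸ 2) → Fin n) λ c →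
          IsCycleIn G (InV G M) (2 * m ∸ 2) c
          × Σ (Fin (m ∸ 2) → Fin m) λ f →
              Injective _≡_ _≡_ f × (∀ j → CycleEdge G (2 * m ∸ 2) c (M (f j))))
lemma2p1 G _ S _ zero M _ = ((λ ()) , ((λ { {()} }) , (λ ()) , (λ ())) , (λ ())) , λ ()
lemma2p1 G (col , proper) S (S-edges , close) m@(suc _) M (M-in-S , M-disjoint) =
  SpanningPath⇒PathThrough (hamiltonianPath (allFin⁺ m)) ,
  λ 4≤m → AlmostHamiltonian⇒CycleThrough 4≤m
            (almostHamiltonian (allFin⁺ m) (subst (4 ≤_) (sym (length-tabulate id)) 4≤m))
  where
    open Bipartition G col proper
    open Matching M (λ i → S-edges _ (M-in-S i)) M-disjoint
    open Semicomplete _⟶_ (λ {i} {j} i≢j → compare i≢j (close _ _ (M-in-S i) (M-in-S j)))
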